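{- Let $n$ be a positive integer, $n-1<s\le n$, and $A\in\omega_n^s$. If there exist $n\times n$ permutation matrices $P$ and $Q$ and an integer $0\le m\le n$ such that $$PAQ=I_{n-m}\oplus B_m(s-n+1),$$ then $A$ is an extreme point of $\omega_n^s$.
   Context: $\omega_n$ is the set of $n\times n$ nonnegative real matrices with all row and column sums at most $1$; $\omega_n^s$ is the set of $A\in\omega_n$ whose entries sum to $s$. $I_r$ is the $r\times r$ identity matrix and $\oplus$ denotes block-diagonal direct sum (a block of size $0$ is omitted). For $0\le\alpha\le1$ and $m\ge1$, $B_m(\alpha)$ is the $m\times m$ matrix with every diagonal entry equal to $\alpha$, every entry in position $(i+1,i)$ ($1\le i\le m-1$) equal to $1-\alpha$, and all other entries $0$. An extreme point of a convex set $C$ is a point of $C$ that is not of the form $\lambda y+(1-\lambda)z$ with $y,z\in C$, $y\ne z$, $0<\lambda<1$. -}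

module Defs where

open import Level using (Level; _⊔_) renaming (suc to lsuc)
open import Algebra.Bundles using (CommutativeRing)
open import Relation.Binary.Structures using (IsTotalOrder)
open import Relation.Nullary using (¬_; yes; no)
open import Data.Nat as ℕ using (ℕ; zero; suc)
open import Data.Fin as Fin using (Fin; toℕ; cast)
open import Data.Fin.Permutation using (Permutation′; _⟨$⟩ʳ_)
open import Data.Sum using (inj₁; inj₂)
open import Data.Product using (Σ; _×_; _,_)
open import Relation.Binary.PropositionalEquality using (_≡_) renaming (sym to ≡-sym)

-- An ordered field (the real numbers ℝ are the intended instance):
-- a commutative ring with a total order compatible with + and *,
-- 0 ≉ 1, and multiplicative inverses of all nonzero elements.
record OrderedField (c ℓ₁ ℓ₂ : Level) : Set (lsuc (c ⊔ ℓ₁ ⊔ ℓ₂)) where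
  field
    commutativeRing : CommutativeRing c ℓ₁
  open CommutativeRing commutativeRing public
  field
    _≤_          : Carrier → Carrier → Set ℓ₂
    isTotalOrder : IsTotalOrder _≈_ _≤_
    0≉1          : ¬ (0# ≈ 1#)
    _⁻¹          : (x : Carrier) → ¬ (x ≈ 0#) → Carrier
    ⁻¹-inverse   : (x : Carrier) (p : ¬ (x ≈ 0#)) → x * (x ⁻¹) p ≈ 1#
    +-mono-≤     : ∀ {x y} z → x ≤ y → (x + z) ≤ (y + z)
    *-nonneg     : ∀ {x y} → 0# ≤ x → 0# ≤ y → 0# ≤ (x * y)

  _<_ : Carrier → Carrier → Set (ℓ₁ ⊔ ℓ₂)
  x < y = (x ≤ y) × ¬ (x ≈ y)

  fromℕ : ℕ → Carrier
  fromℕ zero    = 0#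
  fromℕ (suc n) = 1# + fromℕ n

module OrderedFieldMatrices {c ℓ₁ ℓ₂} (F : OrderedField c ℓ₁ ℓ₂) where
  open OrderedField F

  Matrix : ℕ → Set c
  Matrix n = Fin n → Fin n → Carrier

  sumFin : ∀ n → (Fin n → Carrier) → Carrier
  sumFin zero    f = 0#
  sumFin (suc n) f = f Fin.zero + sumFin n (λ i → f (Fin.suc i))

  rowSum : ∀ {n} → Matrix n → Fin n → Carrier
  rowSum {n} A i = sumFin n (λ j → A i j)

  colSum : ∀ {n} → Matrix n → Fin n → Carrier
  colSum {n} A j = sumFin n (λ i → A i j)

  entrySum : ∀ {n} → Matrix n → Carrier
  entrySum {n} A = sumFin n (λ i → rowSum A i)

  _≈ᴹ_ : ∀ {n} → Matrix n → Matrix n → Set ℓ₁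
  A ≈ᴹ B = ∀ i j → A i j ≈ B i j

  _*ᴹ_ : ∀ {n} → Matrix n → Matrix n → Matrix n
  _*ᴹ_ {n} A B i k = sumFin n (λ j → A i j * B j k)

  convex : ∀ {n} → Carrier → Matrix n → Matrix n → Matrix n
  convex t Y Z i j = t * Y i j + (1# - t) * Z i j

  ω : ∀ n → Matrix n → Set (ℓ₂)
  ω n A = (∀ i j → 0# ≤ A i j) × (∀ i → rowSum A i ≤ 1#) × (∀ j → colSum A j ≤ 1#)

  ωˢ : ∀ n → Carrier → Matrix n → Set (ℓ₁ ⊔ ℓ₂)
  ωˢ n s A = ω n A × (entrySum A ≈ s)

  IsExtremePoint : ∀ {n} {ℓ} → (Matrix n → Set ℓ) → Matrix n → Set (c ⊔ ℓ ⊔ ℓ₁ ⊔ ℓ₂)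
  IsExtremePoint {n} C A =
    C A × ¬ (Σ (Matrix n) λ Y → Σ (Matrix n) λ Z → Σ Carrier λ t →
              C Y × C Z × ¬ (Y ≈ᴹ Z) × (0# < t) × (t < 1#) × (A ≈ᴹ convex t Y Z))

  permMatrix : ∀ {n} → Permutation′ n → Matrix n
  permMatrix π i j with (π ⟨$⟩ʳ i) Fin.≟ j
  ... | yes _ = 1#
  ... | no  _ = 0#

  I : ∀ r → Matrix r
  I r i j with i Fin.≟ j
  ... | yes _ = 1#
  ... | no  _ = 0#

  B : ∀ m → Carrier → Matrix m
  B m α i j with i Fin.≟ j
  ... | yes _ = α
  ... | no  _ with toℕ i ℕ.≟ suc (toℕ j)
  ...   | yes _ = 1# - α
  ...   | no  _ = 0#

  _⊕_ : ∀ {a b} → Matrix a → Matrix b → Matrix (a ℕ.+ b)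
  _⊕_ {a} {b} X Y i j with Fin.splitAt a i | Fin.splitAt a j
  ... | inj₁ i′ | inj₁ j′ = X i′ j′
  ... | inj₂ i′ | inj₂ j′ = Y i′ j′
  ... | _ | _ = 0#

  castᴹ : ∀ {a b} → a ≡ b → Matrix a → Matrix b
  castᴹ eq M i j = M (cast (≡-sym eq) i) (cast (≡-sym eq) j)

-- Permuting rows and columns preserves ω_n^s, so it suffices to show that
-- C = I_k ⊕ B_m(α) is not t Y + (1 - t) Z with Y ≠ Z in ω_n^s and 0 < t < 1.
-- Such Y and Z vanish wherever C does, and have row (column) sum 1 wherever
-- C does. That is every row except row k (rows counted from 0, so row k is
-- the first row of B_m), and every column of B_m except the last; since Y
-- and Z both have total s, their k-th row sums agree as well. Hence Y and Z
-- agree on the diagonal of I_k and at (k, k), and then down the bidiagonal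
-- block: the column through a diagonal entry fixes the subdiagonal entry
-- below it, and that entry's row fixes the next diagonal entry.
module Submission where

open import Defs
open import Level using (Level)
open import Data.Nat using (ℕ) renaming (_≤_ to _≤ℕ_; _+_ to _+ℕ_)
open import Data.Fin.Permutation using (Permutation′)
open import Data.Product using (Σ; _×_)
open import Relation.Binary.PropositionalEquality using (_≡_)

open import Data.Nat using (zero; suc; z≤n; z<s)
  renaming (_<_ to _<ℕ_; _≟_ to _≟ℕ_; _≤?_ to _≤?ℕ_; _<?_ to _<?ℕ_)
import Data.Nat.Properties as ℕ
open import Data.Fin as Fin using (Fin; zero; suc; toℕ; fromℕ<; reduce≥; _↑ʳ_)
open import Data.Fin.Properties
  using ( toℕ-injective; toℕ-inject₁; fromℕ<-injective; toℕ-↑ʳ; suc-injective; cast-is-id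
        ; splitAt-<; splitAt-≥; splitAt⁻¹-↑ʳ)
open import Data.Fin.Permutation using (_⟨$⟩ʳ_; _⟨$⟩ˡ_; flip; inverseˡ; inverseʳ)
open import Data.Product using (_,_; proj₁; proj₂; map)
open import Data.Empty using (⊥-elim)
open import Function using (_∘_)
open import Relation.Nullary using (¬_; yes; no)
open import Relation.Nullary.Decidable using (_×-dec_)
open import Relation.Binary.Structures using (IsTotalOrder)
open import Relation.Binary.PropositionalEquality as ≡ using (_≢_)

↑ʳ-reduce≥ : ∀ k {m} (x : Fin (k +ℕ m)) .(k≤x : k ≤ℕ toℕ x) → k ↑ʳ reduce≥ x k≤x ≡ x
↑ʳ-reduce≥ k x k≤x = splitAt⁻¹-↑ʳ (splitAt-≥ k x k≤x)

toℕ-reduce≥ : ∀ k {m} (x : Fin (k +ℕ m)) .(k≤x : k ≤ℕ toℕ x) → k +ℕ toℕ (reduce≥ x k≤x) ≡ toℕ x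
toℕ-reduce≥ k x k≤x = ≡.trans (≡.sym (toℕ-↑ʳ k _)) (≡.cong toℕ (↑ʳ-reduce≥ k x k≤x))

reduce≥-injective : ∀ k {m} {x y : Fin (k +ℕ m)} .{k≤x : k ≤ℕ toℕ x} .{k≤y : k ≤ℕ toℕ y} →
                    reduce≥ x k≤x ≡ reduce≥ y k≤y → x ≡ y
reduce≥-injective k {x = x} {y} x′≡y′ =
  ≡.trans (≡.sym (↑ʳ-reduce≥ k x _)) (≡.trans (≡.cong (k ↑ʳ_) x′≡y′) (↑ʳ-reduce≥ k y _))

toℕ-reduce≥-subdiag : ∀ k {m} {x y : Fin (k +ℕ m)} .{k≤x : k ≤ℕ toℕ x} .{k≤y : k ≤ℕ toℕ y} →
                      toℕ x ≡ suc (toℕ y) → toℕ (reduce≥ x k≤x) ≡ suc (toℕ (reduce≥ y k≤y))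
toℕ-reduce≥-subdiag k {x = x} {y} x≡1+y = ℕ.+-cancelˡ-≡ k _ _ (begin
  k +ℕ toℕ (reduce≥ x _)        ≡⟨ toℕ-reduce≥ k x _ ⟩
  toℕ x                         ≡⟨ x≡1+y ⟩
  suc (toℕ y)                   ≡⟨ ≡.cong suc (toℕ-reduce≥ k y _) ⟨
  suc (k +ℕ toℕ (reduce≥ y _))  ≡⟨ ℕ.+-suc k _ ⟨
  k +ℕ suc (toℕ (reduce≥ y _))  ∎)
  where open ≡.≡-Reasoning

toℕ-reduce≥-subdiag⁻¹ : ∀ k {m} {x y : Fin (k +ℕ m)} .{k≤x : k ≤ℕ toℕ x} .{k≤y : k ≤ℕ toℕ y} →
                        toℕ (reduce≥ x k≤x) ≡ suc (toℕ (reduce≥ y k≤y)) → toℕ x ≡ suc (toℕ y)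
toℕ-reduce≥-subdiag⁻¹ k {x = x} {y} x′≡1+y′ = begin
  toℕ x                         ≡⟨ toℕ-reduce≥ k x _ ⟨
  k +ℕ toℕ (reduce≥ x _)        ≡⟨ ≡.cong (k +ℕ_) x′≡1+y′ ⟩
  k +ℕ suc (toℕ (reduce≥ y _))  ≡⟨ ℕ.+-suc k _ ⟩
  suc (k +ℕ toℕ (reduce≥ y _))  ≡⟨ ≡.cong suc (toℕ-reduce≥ k y _) ⟩
  suc (toℕ y)                   ∎
  where open ≡.≡-Reasoning

sub≢diag : ∀ {n} {i j : Fin n} → toℕ i ≡ suc (toℕ j) → i ≢ j
sub≢diag i≡1+j ≡.refl = ℕ.1+n≢n (≡.sym i≡1+j)

predecessor : ∀ {n} (i : Fin n) → 0 <ℕ toℕ i → Σ (Fin n) (λ j → toℕ i ≡ suc (toℕ j))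
predecessor (suc i) _ = Fin.inject₁ i , ≡.cong suc (≡.sym (toℕ-inject₁ i))

module ExtremePoints {c ℓ₁ ℓ₂ : Level} (F : OrderedField c ℓ₁ ℓ₂) where
  open OrderedField F hiding (zero)
  open OrderedFieldMatrices F
  open import Algebra.Properties.Group +-group using (∙-cancelˡ; ∙-cancelʳ; x∙y⁻¹≈ε⇒x≈y)
  open import Algebra.Properties.AbelianGroup +-abelianGroup using (⁻¹-∙-comm; xyx⁻¹≈y)
  open import Algebra.Properties.CommutativeSemigroup +-commutativeSemigroup using (interchange)
  open import Algebra.Properties.Ring ring using (x[y-z]≈xy-xz)
  open import Algebra.Properties.Semiring.Sum semiring using (sum; ∑-distrib-+; *-distribˡ-sum; sum-permute)
  open import Relation.Binary.Reasoning.Setoid setoid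
  private module ≤ = IsTotalOrder isTotalOrder

  +-cancelˡ-≈ : ∀ {a b x y} → a ≈ b → a + x ≈ b + y → x ≈ y
  +-cancelˡ-≈ {a} {b} {x} {y} a≈b e = ∙-cancelˡ a x y (trans e (+-congʳ (sym a≈b)))

  +-cancelʳ-≈ : ∀ {a b x y} → a ≈ b → x + a ≈ y + b → x ≈ y
  +-cancelʳ-≈ {a} {b} {x} {y} a≈b e = ∙-cancelʳ a x y (trans e (+-congˡ (sym a≈b)))

  x+[1-x]≈1 : ∀ x → x + (1# - x) ≈ 1#
  x+[1-x]≈1 x = trans (sym (+-assoc x 1# (- x))) (xyx⁻¹≈y x 1#)

  1-x≈0⇒x≈1 : ∀ {x} → 1# - x ≈ 0# → x ≈ 1#
  1-x≈0⇒x≈1 {x} e = sym (x∙y⁻¹≈ε⇒x≈y 1# x e)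

  x≤y⇒0≤y-x : ∀ {x y} → x ≤ y → 0# ≤ (y - x)
  x≤y⇒0≤y-x {x} x≤y = ≤.≲-respˡ-≈ (-‿inverseʳ x) (+-mono-≤ (- x) x≤y)

  x<1⇒0<1-x : ∀ {x} → x < 1# → 0# < (1# - x)
  x<1⇒0<1-x (x≤1 , x≉1) = x≤y⇒0≤y-x x≤1 , λ 0≈1-x → x≉1 (1-x≈0⇒x≈1 (sym 0≈1-x))

  nonneg-+-≈0 : ∀ {x y} → 0# ≤ x → 0# ≤ y → x + y ≈ 0# → x ≈ 0# × y ≈ 0#
  nonneg-+-≈0 0≤x 0≤y x+y≈0 = ≈0 0≤x 0≤y x+y≈0 , ≈0 0≤y 0≤x (trans (+-comm _ _) x+y≈0)
    where
    ≈0 : ∀ {x y} → 0# ≤ x → 0# ≤ y → x + y ≈ 0# → x ≈ 0#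
    ≈0 {x} {y} 0≤x 0≤y x+y≈0 = ≤.antisym x≤0 0≤x
      where
      x≤0 : x ≤ 0#
      x≤0 = ≤.≲-respʳ-≈ (trans (+-comm y x) x+y≈0) (≤.≲-respˡ-≈ (+-identityˡ x) (+-mono-≤ x 0≤y))

  pos-*-≈0 : ∀ {t x} → 0# < t → t * x ≈ 0# → x ≈ 0#
  pos-*-≈0 {t} {x} (_ , 0≉t) tx≈0 = begin
    x               ≈⟨ *-identityˡ x ⟨
    1# * x          ≈⟨ *-congʳ (trans (*-comm t⁻¹ t) (⁻¹-inverse t t≉0)) ⟨
    (t⁻¹ * t) * x   ≈⟨ *-assoc t⁻¹ t x ⟩
    t⁻¹ * (t * x)   ≈⟨ *-congˡ tx≈0 ⟩
    t⁻¹ * 0#        ≈⟨ zeroʳ t⁻¹ ⟩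
    0#              ∎
    where
    t≉0 : ¬ (t ≈ 0#)
    t≉0 = 0≉t ∘ sym
    t⁻¹ : Carrier
    t⁻¹ = (t ⁻¹) t≉0

  convex-≈0 : ∀ {t y z} → 0# < t → t < 1# → 0# ≤ y → 0# ≤ z →
              t * y + (1# - t) * z ≈ 0# → y ≈ 0# × z ≈ 0#
  convex-≈0 0<t t<1 0≤y 0≤z e =
    map (pos-*-≈0 0<t) (pos-*-≈0 0<1-t) (nonneg-+-≈0 (*-nonneg (proj₁ 0<t) 0≤y) (*-nonneg (proj₁ 0<1-t) 0≤z) e)
    where 0<1-t = x<1⇒0<1-x t<1

  convex-≈1 : ∀ {t y z} → 0# < t → t < 1# → y ≤ 1# → z ≤ 1# →
              t * y + (1# - t) * z ≈ 1# → y ≈ 1# × z ≈ 1#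
  convex-≈1 {t} {y} {z} 0<t t<1 y≤1 z≤1 e =
    map 1-x≈0⇒x≈1 1-x≈0⇒x≈1 (convex-≈0 0<t t<1 (x≤y⇒0≤y-x y≤1) (x≤y⇒0≤y-x z≤1) slack≈0)
    where
    slack≈0 : t * (1# - y) + (1# - t) * (1# - z) ≈ 0#
    slack≈0 = begin
      t * (1# - y) + (1# - t) * (1# - z)
        ≈⟨ +-cong (x[y-z]≈xy-xz t 1# y) (x[y-z]≈xy-xz (1# - t) 1# z) ⟩
      (t * 1# - t * y) + ((1# - t) * 1# - (1# - t) * z)
        ≈⟨ interchange _ _ _ _ ⟩
      (t * 1# + (1# - t) * 1#) + (- (t * y) - (1# - t) * z)
        ≈⟨ +-cong (sym (distribʳ 1# t (1# - t))) (⁻¹-∙-comm _ _) ⟩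
      (t + (1# - t)) * 1# - (t * y + (1# - t) * z)
        ≈⟨ +-cong (trans (*-identityʳ _) (x+[1-x]≈1 t)) (-‿cong e) ⟩
      1# - 1#
        ≈⟨ -‿inverseʳ 1# ⟩
      0# ∎

  sumFin-cong : ∀ n {f g : Fin n → Carrier} → (∀ i → f i ≈ g i) → sumFin n f ≈ sumFin n g
  sumFin-cong zero    f≈g = refl
  sumFin-cong (suc n) f≈g = +-cong (f≈g zero) (sumFin-cong n (f≈g ∘ suc))

  sumFin≡sum : ∀ n (f : Fin n → Carrier) → sumFin n f ≡ sum f
  sumFin≡sum zero    f = ≡.refl
  sumFin≡sum (suc n) f = ≡.cong (f zero +_) (sumFin≡sum n (f ∘ suc))

  sumFin-linear : ∀ n t u (f g : Fin n → Carrier) →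
                  sumFin n (λ i → t * f i + u * g i) ≈ t * sumFin n f + u * sumFin n g
  sumFin-linear n t u f g = begin
    sumFin n (λ i → t * f i + u * g i)  ≡⟨ sumFin≡sum n _ ⟩
    sum (λ i → t * f i + u * g i)       ≈⟨ ∑-distrib-+ (λ i → t * f i) (λ i → u * g i) ⟩
    sum (λ i → t * f i) + sum (λ i → u * g i)
      ≈⟨ +-cong (*-distribˡ-sum t f) (*-distribˡ-sum u g) ⟨
    t * sum f + u * sum g               ≡⟨ ≡.cong₂ (λ a b → t * a + u * b) (sumFin≡sum n f) (sumFin≡sum n g) ⟨
    t * sumFin n f + u * sumFin n g     ∎

  sumFin-permute : ∀ n (π : Permutation′ n) (f : Fin n → Carrier) →
                   sumFin n (λ i → f (π ⟨$⟩ʳ i)) ≈ sumFin n f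
  sumFin-permute n π f = begin
    sumFin n (λ i → f (π ⟨$⟩ʳ i))  ≡⟨ sumFin≡sum n _ ⟩
    sum (λ i → f (π ⟨$⟩ʳ i))       ≈⟨ sum-permute f π ⟨
    sum f                          ≡⟨ sumFin≡sum n f ⟨
    sumFin n f                     ∎

  sumFin-≈0 : ∀ n {f : Fin n → Carrier} → (∀ i → f i ≈ 0#) → sumFin n f ≈ 0#
  sumFin-≈0 zero    f≈0 = refl
  sumFin-≈0 (suc n) f≈0 = trans (+-cong (f≈0 zero) (sumFin-≈0 n (f≈0 ∘ suc))) (+-identityʳ 0#)

  sumFin-single : ∀ n {f : Fin n → Carrier} (a : Fin n) →
                  (∀ j → j ≢ a → f j ≈ 0#) → sumFin n f ≈ f a
  sumFin-single (suc n) zero    f≈0 =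
    trans (+-congˡ (sumFin-≈0 n (λ j → f≈0 (suc j) (λ ())))) (+-identityʳ _)
  sumFin-single (suc n) (suc a) f≈0 =
    trans (+-cong (f≈0 zero (λ ())) (sumFin-single n a (λ j j≢a → f≈0 (suc j) (j≢a ∘ suc-injective))))
          (+-identityˡ _)

  sumFin-pair : ∀ n {f : Fin n → Carrier} (a b : Fin n) → a ≢ b →
                (∀ j → j ≢ a → j ≢ b → f j ≈ 0#) → sumFin n f ≈ f a + f b
  sumFin-pair (suc n) zero    zero    a≢b f≈0 = ⊥-elim (a≢b ≡.refl)
  sumFin-pair (suc n) zero    (suc b) a≢b f≈0 =
    +-congˡ (sumFin-single n b (λ j j≢b → f≈0 (suc j) (λ ()) (j≢b ∘ suc-injective)))
  sumFin-pair (suc n) (suc a) zero    a≢b f≈0 =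
    trans (+-congˡ (sumFin-single n a (λ j j≢a → f≈0 (suc j) (j≢a ∘ suc-injective) (λ ())))) (+-comm _ _)
  sumFin-pair (suc n) (suc a) (suc b) a≢b f≈0 =
    trans (+-cong (f≈0 zero (λ ()) (λ ()))
                  (sumFin-pair n a b (a≢b ∘ ≡.cong suc)
                     (λ j j≢a j≢b → f≈0 (suc j) (j≢a ∘ suc-injective) (j≢b ∘ suc-injective))))
          (+-identityˡ _)

  sumFin-≈-except⇒≈ : ∀ n {f g : Fin n → Carrier} (a : Fin n) →
                (∀ j → j ≢ a → f j ≈ g j) → sumFin n f ≈ sumFin n g → f a ≈ g a
  sumFin-≈-except⇒≈ (suc n) zero    f≈g Σf≈Σg =
    +-cancelʳ-≈ (sumFin-cong n (λ j → f≈g (suc j) (λ ()))) Σf≈Σg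
  sumFin-≈-except⇒≈ (suc n) (suc a) f≈g Σf≈Σg =
    sumFin-≈-except⇒≈ n a (λ j j≢a → f≈g (suc j) (j≢a ∘ suc-injective))
                         (+-cancelˡ-≈ (f≈g zero (λ ())) Σf≈Σg)

  module _ {n t} {C Y Z : Matrix n} (0<t : 0# < t) (t<1 : t < 1#) (Y∈ω : ω n Y) (Z∈ω : ω n Z)
           (C≈tY+[1-t]Z : C ≈ᴹ convex t Y Z) where

    convex-entry-≈0 : ∀ i j → C i j ≈ 0# → Y i j ≈ 0# × Z i j ≈ 0#
    convex-entry-≈0 i j Cij≈0 =
      convex-≈0 0<t t<1 (proj₁ Y∈ω i j) (proj₁ Z∈ω i j) (trans (sym (C≈tY+[1-t]Z i j)) Cij≈0)

    convex-rowSum-≈1 : ∀ i → rowSum C i ≈ 1# → rowSum Y i ≈ 1# × rowSum Z i ≈ 1#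
    convex-rowSum-≈1 i rowC≈1 = convex-≈1 0<t t<1 (proj₁ (proj₂ Y∈ω) i) (proj₁ (proj₂ Z∈ω) i) (begin
      t * rowSum Y i + (1# - t) * rowSum Z i  ≈⟨ sumFin-linear n t (1# - t) (Y i) (Z i) ⟨
      sumFin n (convex t Y Z i)                ≈⟨ sumFin-cong n (C≈tY+[1-t]Z i) ⟨
      rowSum C i                               ≈⟨ rowC≈1 ⟩
      1#                                       ∎)

    convex-colSum-≈1 : ∀ j → colSum C j ≈ 1# → colSum Y j ≈ 1# × colSum Z j ≈ 1#
    convex-colSum-≈1 j colC≈1 = convex-≈1 0<t t<1 (proj₂ (proj₂ Y∈ω) j) (proj₂ (proj₂ Z∈ω) j) (begin
      t * colSum Y j + (1# - t) * colSum Z j       ≈⟨ sumFin-linear n t (1# - t) (λ i → Y i j) (λ i → Z i j) ⟨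
      sumFin n (λ i → convex t Y Z i j)            ≈⟨ sumFin-cong n (λ i → C≈tY+[1-t]Z i j) ⟨
      colSum C j                                   ≈⟨ colC≈1 ⟩
      1#                                           ∎)

  permute : ∀ {n} → Permutation′ n → Permutation′ n → Matrix n → Matrix n
  permute P Q X i j = X (P ⟨$⟩ʳ i) (Q ⟨$⟩ˡ j)

  permMatrix-≈1 : ∀ {n} (π : Permutation′ n) {i j} → π ⟨$⟩ʳ i ≡ j → permMatrix π i j ≈ 1#
  permMatrix-≈1 π {i} {j} πi≡j with (π ⟨$⟩ʳ i) Fin.≟ j
  ... | yes _    = refl
  ... | no πi≢j  = ⊥-elim (πi≢j πi≡j)

  permMatrix-≈0 : ∀ {n} (π : Permutation′ n) {i j} → π ⟨$⟩ʳ i ≢ j → permMatrix π i j ≈ 0#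
  permMatrix-≈0 π {i} {j} πi≢j with (π ⟨$⟩ʳ i) Fin.≟ j
  ... | yes πi≡j = ⊥-elim (πi≢j πi≡j)
  ... | no _     = refl

  permMatrix-*ᴹ : ∀ {n} (P : Permutation′ n) (X : Matrix n) i j →
                  (permMatrix P *ᴹ X) i j ≈ X (P ⟨$⟩ʳ i) j
  permMatrix-*ᴹ {n} P X i j = begin
    sumFin n (λ l → permMatrix P i l * X l j)      ≈⟨ sumFin-single n (P ⟨$⟩ʳ i) off-support ⟩
    permMatrix P i (P ⟨$⟩ʳ i) * X (P ⟨$⟩ʳ i) j     ≈⟨ *-congʳ (permMatrix-≈1 P ≡.refl) ⟩
    1# * X (P ⟨$⟩ʳ i) j                            ≈⟨ *-identityˡ _ ⟩
    X (P ⟨$⟩ʳ i) j                                 ∎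
    where
    off-support : ∀ l → l ≢ P ⟨$⟩ʳ i → permMatrix P i l * X l j ≈ 0#
    off-support l l≢Pi = trans (*-congʳ (permMatrix-≈0 P (l≢Pi ∘ ≡.sym))) (zeroˡ _)

  *ᴹ-permMatrix : ∀ {n} (X : Matrix n) (Q : Permutation′ n) i j →
                  (X *ᴹ permMatrix Q) i j ≈ X i (Q ⟨$⟩ˡ j)
  *ᴹ-permMatrix {n} X Q i j = begin
    sumFin n (λ l → X i l * permMatrix Q l j)      ≈⟨ sumFin-single n (Q ⟨$⟩ˡ j) off-support ⟩
    X i (Q ⟨$⟩ˡ j) * permMatrix Q (Q ⟨$⟩ˡ j) j     ≈⟨ *-congˡ (permMatrix-≈1 Q (inverseʳ Q)) ⟩
    X i (Q ⟨$⟩ˡ j) * 1#                            ≈⟨ *-identityʳ _ ⟩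
    X i (Q ⟨$⟩ˡ j)                                 ∎
    where
    off-support : ∀ l → l ≢ Q ⟨$⟩ˡ j → X i l * permMatrix Q l j ≈ 0#
    off-support l l≢Q⁻¹j = trans (*-congˡ (permMatrix-≈0 Q (l≢Q⁻¹j ∘ Ql≡j⇒l≡Q⁻¹j))) (zeroʳ _)
      where
      Ql≡j⇒l≡Q⁻¹j : Q ⟨$⟩ʳ l ≡ j → l ≡ Q ⟨$⟩ˡ j
      Ql≡j⇒l≡Q⁻¹j Ql≡j = ≡.trans (≡.sym (inverseˡ Q)) (≡.cong (Q ⟨$⟩ˡ_) Ql≡j)

  permMatrix-*ᴹ-permMatrix : ∀ {n} (P Q : Permutation′ n) (X : Matrix n) →
                             ((permMatrix P *ᴹ X) *ᴹ permMatrix Q) ≈ᴹ permute P Q X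
  permMatrix-*ᴹ-permMatrix P Q X i j =
    trans (*ᴹ-permMatrix (permMatrix P *ᴹ X) Q i j) (permMatrix-*ᴹ P X i (Q ⟨$⟩ˡ j))

  ωˢ-permute : ∀ {n s} (P Q : Permutation′ n) {X : Matrix n} → ωˢ n s X → ωˢ n s (permute P Q X)
  ωˢ-permute {n} P Q {X} ((0≤X , rowX≤1 , colX≤1) , ΣX≈s) =
    ( (λ i j → 0≤X _ _)
    , (λ i → ≤.≲-respˡ-≈ (sym (row≈ i)) (rowX≤1 _))
    , (λ j → ≤.≲-respˡ-≈ (sym (col≈ j)) (colX≤1 _))) ,
    trans (sumFin-cong n row≈) (trans (sumFin-permute n P (rowSum X)) ΣX≈s)
    where
    row≈ : ∀ i → rowSum (permute P Q X) i ≈ rowSum X (P ⟨$⟩ʳ i)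
    row≈ i = sumFin-permute n (flip Q) (X (P ⟨$⟩ʳ i))
    col≈ : ∀ j → colSum (permute P Q X) j ≈ colSum X (Q ⟨$⟩ˡ j)
    col≈ j = sumFin-permute n P (λ i → X i (Q ⟨$⟩ˡ j))

  permute-cancel : ∀ {n} (P Q : Permutation′ n) {X Y : Matrix n} →
                   permute P Q X ≈ᴹ permute P Q Y → X ≈ᴹ Y
  permute-cancel P Q {X} {Y} PXQ≈PYQ a b = begin
    X a b                                        ≡⟨ ≡.cong₂ X (inverseʳ P) (inverseˡ Q) ⟨
    X (P ⟨$⟩ʳ (P ⟨$⟩ˡ a)) (Q ⟨$⟩ˡ (Q ⟨$⟩ʳ b))     ≈⟨ PXQ≈PYQ (P ⟨$⟩ˡ a) (Q ⟨$⟩ʳ b) ⟩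
    Y (P ⟨$⟩ʳ (P ⟨$⟩ˡ a)) (Q ⟨$⟩ˡ (Q ⟨$⟩ʳ b))     ≡⟨ ≡.cong₂ Y (inverseʳ P) (inverseˡ Q) ⟩
    Y a b                                        ∎

  -- The support of I_k ⊕ B_m: the diagonal and the entries (j + 1, j) with k ≤ j.
  BandSupported : ∀ {n} → ℕ → Matrix n → Set ℓ₁
  BandSupported k X = ∀ i j → i ≢ j → (toℕ i ≡ suc (toℕ j) → toℕ j <ℕ k) → X i j ≈ 0#

  module _ {n k : ℕ} {X : Matrix n} (X-band : BandSupported k X) where

    rowSum-band-upper : ∀ i → toℕ i ≤ℕ k → rowSum X i ≈ X i i
    rowSum-band-upper i i≤k = sumFin-single n i (λ j j≢i →
      X-band i j (j≢i ∘ ≡.sym) (λ i≡1+j → ≡.subst (_≤ℕ k) i≡1+j i≤k))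

    rowSum-band-lower : ∀ i j → toℕ i ≡ suc (toℕ j) → rowSum X i ≈ X i i + X i j
    rowSum-band-lower i j i≡1+j = sumFin-pair n i j (sub≢diag i≡1+j) (λ l l≢i l≢j →
      X-band i l (l≢i ∘ ≡.sym) (λ i≡1+l →
        ⊥-elim (l≢j (toℕ-injective (ℕ.suc-injective (≡.trans (≡.sym i≡1+l) i≡1+j))))))

    colSum-band : ∀ i j → toℕ i ≡ suc (toℕ j) → colSum X j ≈ X j j + X i j
    colSum-band i j i≡1+j = sumFin-pair n j i (sub≢diag i≡1+j ∘ ≡.sym) (λ l l≢j l≢i →
      X-band l j l≢j (λ l≡1+j → ⊥-elim (l≢i (toℕ-injective (≡.trans l≡1+j (≡.sym i≡1+j))))))

  module _ {n k : ℕ} {X Y : Matrix n} (X-band : BandSupported k X) (Y-band : BandSupported k Y)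
           (row≈ : ∀ i → rowSum X i ≈ rowSum Y i)
           (col≈ : ∀ (i j : Fin n) → toℕ i ≡ suc (toℕ j) → k ≤ℕ toℕ j → colSum X j ≈ colSum Y j) where

    band-subdiag-≈ : ∀ i j → toℕ i ≡ suc (toℕ j) → k ≤ℕ toℕ j → X j j ≈ Y j j → X i j ≈ Y i j
    band-subdiag-≈ i j i≡1+j k≤j Xjj≈Yjj = +-cancelˡ-≈ Xjj≈Yjj (begin
      X j j + X i j   ≈⟨ colSum-band X-band i j i≡1+j ⟨
      colSum X j      ≈⟨ col≈ i j i≡1+j k≤j ⟩
      colSum Y j      ≈⟨ colSum-band Y-band i j i≡1+j ⟩
      Y j j + Y i j   ∎)

    band-diag-≈ : ∀ p i → toℕ i ≡ p → X i i ≈ Y i i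
    band-diag-≈ p i i≡p with p ≤?ℕ k
    ... | yes p≤k = begin
      X i i       ≈⟨ rowSum-band-upper X-band i i≤k ⟨
      rowSum X i  ≈⟨ row≈ i ⟩
      rowSum Y i  ≈⟨ rowSum-band-upper Y-band i i≤k ⟩
      Y i i       ∎
      where i≤k = ≡.subst (_≤ℕ k) (≡.sym i≡p) p≤k
    band-diag-≈ zero    i _     | no 0≰k = ⊥-elim (0≰k z≤n)
    band-diag-≈ (suc q) i i≡1+q | no p≰k with predecessor i (≡.subst (0 <ℕ_) (≡.sym i≡1+q) z<s)
    ... | j , i≡1+j = +-cancelʳ-≈ Xij≈Yij (begin
      X i i + X i j   ≈⟨ rowSum-band-lower X-band i j i≡1+j ⟨
      rowSum X i      ≈⟨ row≈ i ⟩
      rowSum Y i      ≈⟨ rowSum-band-lower Y-band i j i≡1+j ⟩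
      Y i i + Y i j   ∎)
      where
      j≡q = ℕ.suc-injective (≡.trans (≡.sym i≡1+j) i≡1+q)
      k≤j = ≡.subst (k ≤ℕ_) (≡.sym j≡q) (ℕ.≤-pred (ℕ.≰⇒> p≰k))
      Xij≈Yij = band-subdiag-≈ i j i≡1+j k≤j (band-diag-≈ q j j≡q)

    band-≈ᴹ : X ≈ᴹ Y
    band-≈ᴹ i j with i Fin.≟ j
    ... | yes ≡.refl = band-diag-≈ (toℕ i) i ≡.refl
    ... | no  i≢j with toℕ i ≟ℕ suc (toℕ j) ×-dec k ≤?ℕ toℕ j
    ...   | yes (i≡1+j , k≤j) = band-subdiag-≈ i j i≡1+j k≤j (band-diag-≈ (toℕ j) j ≡.refl)
    ...   | no  ¬sub = trans (X-band i j i≢j off-band) (sym (Y-band i j i≢j off-band))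
      where
      off-band : toℕ i ≡ suc (toℕ j) → toℕ j <ℕ k
      off-band i≡1+j = ℕ.≰⇒> (λ k≤j → ¬sub (i≡1+j , k≤j))

  band-unique : ∀ {n} k {X Y : Matrix n} → BandSupported k X → BandSupported k Y →
                entrySum X ≈ entrySum Y →
                (∀ i → toℕ i ≢ k → rowSum X i ≈ rowSum Y i) →
                (∀ (i j : Fin n) → toℕ i ≡ suc (toℕ j) → k ≤ℕ toℕ j → colSum X j ≈ colSum Y j) →
                X ≈ᴹ Y
  band-unique {n} k {X} {Y} X-band Y-band ΣX≈ΣY row≈ col≈ = band-≈ᴹ X-band Y-band all-row≈ col≈
    where
    all-row≈ : ∀ i → rowSum X i ≈ rowSum Y i
    all-row≈ i with toℕ i ≟ℕ k
    ... | no  i≢k = row≈ i i≢k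
    ... | yes i≡k = sumFin-≈-except⇒≈ n i
                      (λ r r≢i → row≈ r (λ r≡k → r≢i (toℕ-injective (≡.trans r≡k (≡.sym i≡k))))) ΣX≈ΣY

  I-diag : ∀ {r} (x : Fin r) → I r x x ≈ 1#
  I-diag x with x Fin.≟ x
  ... | yes _   = refl
  ... | no  x≢x = ⊥-elim (x≢x ≡.refl)

  I-offdiag : ∀ {r} {x y : Fin r} → x ≢ y → I r x y ≈ 0#
  I-offdiag {x = x} {y} x≢y with x Fin.≟ y
  ... | yes x≡y = ⊥-elim (x≢y x≡y)
  ... | no  _   = refl

  module _ (m : ℕ) (α : Carrier) where

    B-diag : ∀ x → B m α x x ≈ α
    B-diag x with x Fin.≟ x
    ... | yes _   = refl
    ... | no  x≢x = ⊥-elim (x≢x ≡.refl)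

    B-subdiag : ∀ {x y} → toℕ x ≡ suc (toℕ y) → B m α x y ≈ 1# - α
    B-subdiag {x} {y} x≡1+y with x Fin.≟ y
    ... | yes x≡y = ⊥-elim (sub≢diag x≡1+y x≡y)
    ... | no  _ with toℕ x ≟ℕ suc (toℕ y)
    ...   | yes _      = refl
    ...   | no  x≢1+y = ⊥-elim (x≢1+y x≡1+y)

    B-off-band : ∀ {x y} → x ≢ y → toℕ x ≢ suc (toℕ y) → B m α x y ≈ 0#
    B-off-band {x} {y} x≢y x≢1+y with x Fin.≟ y
    ... | yes x≡y = ⊥-elim (x≢y x≡y)
    ... | no  _ with toℕ x ≟ℕ suc (toℕ y)
    ...   | yes x≡1+y = ⊥-elim (x≢1+y x≡1+y)
    ...   | no  _     = refl

  module _ (k m : ℕ) (α : Carrier) where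

    ⊕-diag-upper : ∀ x → toℕ x <ℕ k → (I k ⊕ B m α) x x ≈ 1#
    ⊕-diag-upper x x<k rewrite splitAt-< k x x<k = I-diag (fromℕ< x<k)

    ⊕-diag-lower : ∀ x → k ≤ℕ toℕ x → (I k ⊕ B m α) x x ≈ α
    ⊕-diag-lower x k≤x rewrite splitAt-≥ k x k≤x = B-diag m α (reduce≥ x k≤x)

    ⊕-subdiag : ∀ x y → toℕ x ≡ suc (toℕ y) → k ≤ℕ toℕ y → (I k ⊕ B m α) x y ≈ 1# - α
    ⊕-subdiag x y x≡1+y k≤y
      rewrite splitAt-≥ k x (≡.subst (k ≤ℕ_) (≡.sym x≡1+y) (ℕ.m≤n⇒m≤1+n k≤y)) | splitAt-≥ k y k≤y =
      B-subdiag m α (toℕ-reduce≥-subdiag k x≡1+y)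

    ⊕-bandSupported : BandSupported k (I k ⊕ B m α)
    ⊕-bandSupported x y x≢y off-band with toℕ x <?ℕ k | toℕ y <?ℕ k
    ... | yes x<k | yes y<k rewrite splitAt-< k x x<k | splitAt-< k y y<k =
      I-offdiag (x≢y ∘ toℕ-injective ∘ fromℕ<-injective _ _ x<k y<k)
    ... | yes x<k | no  y≮k rewrite splitAt-< k x x<k | splitAt-≥ k y (ℕ.≮⇒≥ y≮k) = refl
    ... | no  x≮k | yes y<k rewrite splitAt-≥ k x (ℕ.≮⇒≥ x≮k) | splitAt-< k y y<k = refl
    ... | no  x≮k | no  y≮k rewrite splitAt-≥ k x (ℕ.≮⇒≥ x≮k) | splitAt-≥ k y (ℕ.≮⇒≥ y≮k) =
      B-off-band m α (x≢y ∘ reduce≥-injective k) (y≮k ∘ off-band ∘ toℕ-reduce≥-subdiag⁻¹ k)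

    ⊕-rowSum-lower : ∀ i → k <ℕ toℕ i → rowSum (I k ⊕ B m α) i ≈ 1#
    ⊕-rowSum-lower i k<i with predecessor i (ℕ.≤-<-trans z≤n k<i)
    ... | j , i≡1+j = begin
      rowSum (I k ⊕ B m α) i                    ≈⟨ rowSum-band-lower ⊕-bandSupported i j i≡1+j ⟩
      (I k ⊕ B m α) i i + (I k ⊕ B m α) i j     ≈⟨ +-cong (⊕-diag-lower i (ℕ.<⇒≤ k<i)) (⊕-subdiag i j i≡1+j k≤j) ⟩
      α + (1# - α)                              ≈⟨ x+[1-x]≈1 α ⟩
      1#                                        ∎
      where k≤j = ℕ.≤-pred (≡.subst (k <ℕ_) i≡1+j k<i)

    ⊕-rowSum : ∀ i → toℕ i ≢ k → rowSum (I k ⊕ B m α) i ≈ 1#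
    ⊕-rowSum i i≢k with toℕ i <?ℕ k
    ... | yes i<k = trans (rowSum-band-upper ⊕-bandSupported i (ℕ.<⇒≤ i<k)) (⊕-diag-upper i i<k)
    ... | no  i≮k = ⊕-rowSum-lower i (ℕ.≤∧≢⇒< (ℕ.≮⇒≥ i≮k) (i≢k ∘ ≡.sym))

    ⊕-colSum : ∀ (i j : Fin (k +ℕ m)) → toℕ i ≡ suc (toℕ j) → k ≤ℕ toℕ j → colSum (I k ⊕ B m α) j ≈ 1#
    ⊕-colSum i j i≡1+j k≤j = begin
      colSum (I k ⊕ B m α) j                    ≈⟨ colSum-band ⊕-bandSupported i j i≡1+j ⟩
      (I k ⊕ B m α) j j + (I k ⊕ B m α) i j     ≈⟨ +-cong (⊕-diag-lower j k≤j) (⊕-subdiag i j i≡1+j k≤j) ⟩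
      α + (1# - α)                              ≈⟨ x+[1-x]≈1 α ⟩
      1#                                        ∎

  ⊕-extreme : ∀ k m α {s t} {Y Z : Matrix (k +ℕ m)} → ωˢ (k +ℕ m) s Y → ωˢ (k +ℕ m) s Z →
              0# < t → t < 1# → (I k ⊕ B m α) ≈ᴹ convex t Y Z → Y ≈ᴹ Z
  ⊕-extreme k m α {Y = Y} {Z} (Y∈ω , ΣY≈s) (Z∈ω , ΣZ≈s) 0<t t<1 M≈tY+[1-t]Z =
    band-unique k (λ i j i≢j off → proj₁ (vanish i j i≢j off)) (λ i j i≢j off → proj₂ (vanish i j i≢j off))
      (trans ΣY≈s (sym ΣZ≈s))
      (λ i i≢k → both-≈1 (convex-rowSum-≈1 0<t t<1 Y∈ω Z∈ω M≈tY+[1-t]Z i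
                            (⊕-rowSum k m α i i≢k)))
      (λ i j i≡1+j k≤j → both-≈1 (convex-colSum-≈1 0<t t<1 Y∈ω Z∈ω M≈tY+[1-t]Z j
                                    (⊕-colSum k m α i j i≡1+j k≤j)))
    where
    vanish : ∀ i j → i ≢ j → (toℕ i ≡ suc (toℕ j) → toℕ j <ℕ k) → Y i j ≈ 0# × Z i j ≈ 0#
    vanish i j i≢j off = convex-entry-≈0 0<t t<1 Y∈ω Z∈ω M≈tY+[1-t]Z i j (⊕-bandSupported k m α i j i≢j off)
    both-≈1 : ∀ {x y} → x ≈ 1# × y ≈ 1# → x ≈ y
    both-≈1 (x≈1 , y≈1) = trans x≈1 (sym y≈1)

  castᴹ-refl : ∀ {n} (X : Matrix n) → castᴹ ≡.refl X ≈ᴹ X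
  castᴹ-refl X i j = reflexive (≡.cong₂ X (cast-is-id ≡.refl i) (cast-is-id ≡.refl j))


corollary4p16 : ∀ {c ℓ₁ ℓ₂ : Level} (F : OrderedField c ℓ₁ ℓ₂) →
    let open OrderedField F
        open OrderedFieldMatrices F
    in (n : ℕ) → 1 ≤ℕ n →
       (s : Carrier) → (fromℕ n - 1#) < s → s ≤ fromℕ n →
       (A : Matrix n) → ωˢ n s A →
       Σ (Permutation′ n) (λ P → Σ (Permutation′ n) (λ Q →
         Σ ℕ (λ k → Σ ℕ (λ m → Σ (k +ℕ m ≡ n) (λ eq →
           ((permMatrix P *ᴹ A) *ᴹ permMatrix Q)
             ≈ᴹ castᴹ eq (I k ⊕ B m (s - fromℕ n + 1#))))))) →
       IsExtremePoint (ωˢ n s) A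
corollary4p16 F _ _ s _ _ A A∈ωˢ (P , Q , k , m , ≡.refl , PAQ≈M) =
  A∈ωˢ , λ (Y , Z , t , Y∈ωˢ , Z∈ωˢ , Y≉Z , 0<t , t<1 , A≈tY+[1-t]Z) →
    Y≉Z (permute-cancel P Q (⊕-extreme k m α (ωˢ-permute P Q Y∈ωˢ) (ωˢ-permute P Q Z∈ωˢ) 0<t t<1
      (λ i j → trans (M≈PAQ i j) (trans (permMatrix-*ᴹ-permMatrix P Q A i j) (A≈tY+[1-t]Z _ _)))))
  where
  open OrderedField F hiding (zero)
  open OrderedFieldMatrices F
  open ExtremePoints F
  α : Carrier
  α = s - fromℕ (k +ℕ m) + 1#
  M≈PAQ : (I k ⊕ B m α) ≈ᴹ ((permMatrix P *ᴹ A) *ᴹ permMatrix Q)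
  M≈PAQ i j = trans (sym (castᴹ-refl (I k ⊕ B m α) i j)) (sym (PAQ≈M i j))
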